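{- Let $c$, $k$ and $t$ be positive integers with $c\ge 6$ and $k\ge t+3$. If $c\ge 4\log_2 t+7$ or $k\ge 2t+3$, then: (i) $h_1(c,k,t)<\max\{(f_0(c,k,t))^2,(f_2(c,k,t))^2\}$; (ii) $h_2(c,k,t)<\max\{(f_0(c,k,t))^2,(f_2(c,k,t))^2\}$; (iii) $h_3(c,k,t)<(f_0(c,k,t))^2$; (iv) $h_4(c,k,t)<(f_2(c,k,t))^2$.
   Context: $\theta(c,k,z)=\frac{1}{(k-z)!}\prod_{i=z}^{k-1}\binom{(k-i)c}{c}$; $f_0(c,k,t)=(k-t-1)\theta(c,k,t+1)-\binom{k-t-1}{2}\theta(c,k,t+2)$. $U^{[ck]}_{c,\ell}$ is the set of families of $\ell$ pairwise disjoint $c$-subsets of $[ck]$, and $f_2(c,k,t)=|\{F\in U^{[ck]}_{c,k}: |F\cap Z|\ge t+1\}|$ for a fixed $Z\in U^{[ck]}_{c,t+2}$ (here $F\cap Z$ is the set of common $c$-subsets); equivalently $f_2(c,k,t)=\theta(c,k,t+1)\bigl((t+2)-\frac{(t+1)(k-t-1)}{\binom{(k-t-1)c}{c}}\bigr)$. With $\rho=\frac{3(t+1)}{2(k-t-1)^{c-3}}$ and $\theta_1=\theta(c,k,t+1)$: $h_1(c,k,t)=((t+1)(k-t-1)+\rho)(1+\rho)\theta_1^2$, $h_2(c,k,t)=((k-1)+\rho)(2+\rho)\theta_1^2$, $h_3(c,k,t)=(k-t-1+\rho)(k-t-2+\rho)\theta_1^2$, $h_4(c,k,t)=\Bigl((t+2)^2-1+\frac{12(t+1)(k-t-1)^3}{\binom{(k-t-1)c}{c}}+\frac{9(t+1)^2}{4(k-t-1)^{2c-6}}\Bigr)\theta_1^2$.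 -}

module Defs where

open import Data.Nat as ℕ using (ℕ; zero; suc; _∸_; _^_)
open import Data.Nat.Combinatorics using (_C_)
open import Data.Nat using (_!)
open import Data.List using (map; upTo)
open import Data.Nat.ListAction using (product)
open import Data.Integer using (+_)
open import Data.Rational using (ℚ; _/_; _+_; _*_; _-_)

-- n / d as a rational; junk value 0 when d = 0 (never used: all
-- denominators below are nonzero under the theorem's hypotheses)
frac : ℕ → ℕ → ℚ
frac n zero    = + 0 / 1
frac n (suc d) = + n / suc d

ι : ℕ → ℚ
ι n = + n / 1

-- ∏_{i=z}^{k-1} f i   (empty product = 1 when k ≤ z)
prodRange : ℕ → ℕ → (ℕ → ℕ) → ℕ
prodRange z k f = product (map (λ j → f (z ℕ.+ j)) (upTo (k ∸ z)))

θ : ℕ → ℕ → ℕ → ℚ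
θ c k z = frac (prodRange z k (λ i → ((k ∸ i) ℕ.* c) C c)) ((k ∸ z) !)

sq : ℚ → ℚ
sq x = x * x

f₀ : ℕ → ℕ → ℕ → ℚ
f₀ c k t = ι (k ∸ t ∸ 1) * θ c k (suc t) - ι ((k ∸ t ∸ 1) C 2) * θ c k (suc (suc t))

-- closed form of f₂ given in the paper
f₂ : ℕ → ℕ → ℕ → ℚ
f₂ c k t = θ c k (suc t) * (ι (t ℕ.+ 2) - frac ((t ℕ.+ 1) ℕ.* (k ∸ t ∸ 1)) (((k ∸ t ∸ 1) ℕ.* c) C c))

ρ : ℕ → ℕ → ℕ → ℚ
ρ c k t = frac (3 ℕ.* (t ℕ.+ 1)) (2 ℕ.* ((k ∸ t ∸ 1) ^ (c ∸ 3)))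

h₁ : ℕ → ℕ → ℕ → ℚ
h₁ c k t = (ι ((t ℕ.+ 1) ℕ.* (k ∸ t ∸ 1)) + ρ c k t) * (ι 1 + ρ c k t) * sq (θ c k (suc t))

h₂ : ℕ → ℕ → ℕ → ℚ
h₂ c k t = (ι (k ∸ 1) + ρ c k t) * (ι 2 + ρ c k t) * sq (θ c k (suc t))

h₃ : ℕ → ℕ → ℕ → ℚ
h₃ c k t = (ι (k ∸ t ∸ 1) + ρ c k t) * (ι (k ∸ t ∸ 2) + ρ c k t) * sq (θ c k (suc t))

h₄ : ℕ → ℕ → ℕ → ℚ
h₄ c k t =
  ( ι ((t ℕ.+ 2) ^ 2 ∸ 1)
  + frac (12 ℕ.* (t ℕ.+ 1) ℕ.* (k ∸ t ∸ 1) ^ 3) (((k ∸ t ∸ 1) ℕ.* c) C c)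
  + frac (9 ℕ.* (t ℕ.+ 1) ^ 2) (4 ℕ.* (k ∸ t ∸ 1) ^ (2 ℕ.* c ∸ 6)))
  * sq (θ c k (suc t))

{-# OPTIONS --safe #-}
module Submission where

-- Write m = k − t − 1, s = t + 1, u = t + 2, D = 2m^(c−3) (so that ρ = 3s/D), B = C(mc, c)
-- and θ = θ(c,k,t+1). Since θ(c,k,t+2) = mθ/B, we have f₀ = θ·m(2B − m(m−1))/(2B) and
-- f₂ = θ(uB − sm)/B, and the binomial bound B ≥ 2m^c = m³D together with (x − y)² ≥ x² − 2xy
-- gives f₀² ≥ θ²(m² − (m−1)/D) and f₂² ≥ θ²(u² − su/D). Likewise m³/B ≤ 1/D gives
-- h₄ ≤ θ²(u² − 1 + 12s/D + 9s²/D²). Multiplied by D²/θ², each of (i)–(iv) becomes an inequality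
-- between natural numbers which holds as soon as D is large compared with s and m. If m > t + 1
-- (in particular if k ≥ 2t + 3), h₁ and h₂ are compared with f₀² and D ≥ 2m³ suffices; otherwise
-- they are compared with f₂², and the hypothesis c ≥ 4 log₂ t + 7, i.e. t⁴ ≤ 2^(c−7), gives the
-- needed D ≥ 32t⁴.

open import Defs

module NatBounds where
  open import Data.Nat
  open import Data.Nat.Properties
  open import Data.Nat.Tactic.RingSolver using (solve-∀; solve)
  open import Data.List using (_∷_; [])
  open import Relation.Binary.PropositionalEquality

  ≤-by : ∀ {a b} w → a + w ≡ b → a ≤ b
  ≤-by {a} w refl = m≤m+n a w

  square-defect : ∀ {x} e y → x ≡ e + y → x * x ≤ e * e + 2 * x * y
  square-defect e y refl = ≤-by (y * y) (solve (e ∷ y ∷ []))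

  <-by-margin : ∀ {Z L e R W} → 0 < Z → R * Z ≤ W + e * Z → L + e < R → L * Z < W
  <-by-margin {Z} {L} {e} {R} {W} Z>0 RZ≤W+eZ L+e<R = +-cancelʳ-< (e * Z) (L * Z) W (begin-strict
    L * Z + e * Z   ≡⟨ *-distribʳ-+ Z L e ⟨
    (L + e) * Z     <⟨ *-monoˡ-< Z {{>-nonZero Z>0}} L+e<R ⟩
    R * Z           ≤⟨ RZ≤W+eZ ⟩
    W + e * Z       ∎)
    where open ≤-Reasoning

  f₀-clear : ∀ {m m₁ B D E L} → E + m * m₁ ≡ 2 * B → m ^ 3 * D ≤ B → 0 < B →
    L + m₁ * D < m * m * (D * D) → L * (2 * B * (2 * B)) < m * E * (m * E) * (D * D)
  f₀-clear {m} {m₁} {B} {D} {E} {L} E≡ B≥ B>0 =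
    <-by-margin {e = m₁ * D} (*-mono-< (*-monoʳ-< 2 B>0) (*-monoʳ-< 2 B>0)) (begin
      m * m * (D * D) * (2 * B * (2 * B))
        ≡⟨ solve (m ∷ B ∷ D ∷ []) ⟩
      m * (2 * B) * (m * (2 * B)) * (D * D)
        ≤⟨ *-monoˡ-≤ (D * D) (square-defect (m * E) (m * m * m₁) 2mB≡mE+m²m₁) ⟩
      (m * E * (m * E) + 2 * (m * (2 * B)) * (m * m * m₁)) * (D * D)
        ≡⟨ solve (m ∷ m₁ ∷ B ∷ D ∷ E ∷ []) ⟩
      m * E * (m * E) * (D * D) + 4 * (B * m₁ * D) * (m * (m * (m * 1)) * D)
        ≤⟨ +-monoʳ-≤ (m * E * (m * E) * (D * D)) (*-monoʳ-≤ (4 * (B * m₁ * D)) B≥) ⟩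
      m * E * (m * E) * (D * D) + 4 * (B * m₁ * D) * B
        ≡⟨ solve (m ∷ m₁ ∷ B ∷ D ∷ E ∷ []) ⟩
      m * E * (m * E) * (D * D) + m₁ * D * (2 * B * (2 * B)) ∎)
    where
    open ≤-Reasoning
    2mB≡mE+m²m₁ : m * (2 * B) ≡ m * E + m * m * m₁
    2mB≡mE+m²m₁ = trans (cong (m *_) (sym E≡)) (solve (m ∷ E ∷ m₁ ∷ []))

  f₂-clear : ∀ {m s u B D E L} → E + s * m ≡ u * B → 2 * m * D ≤ B → 0 < B →
    L + s * u * D < u * u * (D * D) → L * (B * B) < E * E * (D * D)
  f₂-clear {m} {s} {u} {B} {D} {E} {L} E≡ B≥ B>0 = <-by-margin {e = s * u * D} (*-mono-< B>0 B>0) (begin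
    u * u * (D * D) * (B * B)                      ≡⟨ solve (u ∷ B ∷ D ∷ []) ⟩
    u * B * (u * B) * (D * D)                      ≤⟨ *-monoˡ-≤ (D * D) (square-defect E (s * m) (sym E≡)) ⟩
    (E * E + 2 * (u * B) * (s * m)) * (D * D)      ≡⟨ solve (m ∷ s ∷ u ∷ B ∷ D ∷ E ∷ []) ⟩
    E * E * (D * D) + s * u * B * D * (2 * m * D)  ≤⟨ +-monoʳ-≤ (E * E * (D * D)) (*-monoʳ-≤ (s * u * B * D) B≥) ⟩
    E * E * (D * D) + s * u * B * D * B            ≡⟨ solve (s ∷ u ∷ B ∷ D ∷ E ∷ []) ⟩
    E * E * (D * D) + s * u * D * (B * B)          ∎)
    where open ≤-Reasoning

  margin-< : ∀ P δ {R β γ D} → P + δ ≤ R → β + 2 ≤ δ * D → γ < 2 * D →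
    P * (D * D) + β * D + γ < R * (D * D)
  margin-< P δ {R} {β} {γ} {D} P+δ≤R β+2≤δD γ<2D = begin-strict
    P * (D * D) + β * D + γ          <⟨ +-monoʳ-< (P * (D * D) + β * D) γ<2D ⟩
    P * (D * D) + β * D + 2 * D      ≡⟨ solve (P ∷ β ∷ D ∷ []) ⟩
    P * (D * D) + (β + 2) * D        ≤⟨ +-monoʳ-≤ (P * (D * D)) (*-monoˡ-≤ D β+2≤δD) ⟩
    P * (D * D) + δ * D * D          ≡⟨ solve (P ∷ δ ∷ D ∷ []) ⟩
    (P + δ) * (D * D)                ≤⟨ *-monoˡ-≤ (D * D) P+δ≤R ⟩
    R * (D * D)                      ∎
    where open ≤-Reasoning

  ρ-margin-< : ∀ p q {r e} δ {R D} → p * q + δ ≤ R → r * (p + q) + e + 2 ≤ δ * D → r * r < 2 * D →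
    (p * D + r) * (q * D + r) + e * D < R * (D * D)
  ρ-margin-< p q {r} {e} δ {R} {D} pq+δ≤R β+2≤δD r²<2D = begin-strict
    (p * D + r) * (q * D + r) + e * D                ≡⟨ solve (p ∷ q ∷ r ∷ e ∷ D ∷ []) ⟩
    p * q * (D * D) + (r * (p + q) + e) * D + r * r  <⟨ margin-< (p * q) δ pq+δ≤R β+2≤δD r²<2D ⟩
    R * (D * D)                                      ∎
    where open ≤-Reasoning

  m*m≤m^3*D : ∀ {m D} → 2 ≤ m → 0 < D → m * m ≤ m ^ 3 * D
  m*m≤m^3*D {suc (suc a)} {suc d} (s≤s (s≤s z≤n)) _ = ≤-by ((2 + a) * (2 + a) * (1 + a + 2 * d + a * d)) (eq a d)
    where
    eq : ∀ a d → (2 + a) * (2 + a) + (2 + a) * (2 + a) * (1 + a + 2 * d + a * d)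
                 ≡ (2 + a) * ((2 + a) * ((2 + a) * 1)) * suc d
    eq = solve-∀

  2*m*D≤m^3*D : ∀ {m} D → 2 ≤ m → 2 * m * D ≤ m ^ 3 * D
  2*m*D≤m^3*D {suc (suc a)} D (s≤s (s≤s z≤n)) = ≤-by (D * (2 + a) * (2 + 4 * a + a * a)) (eq a D)
    where
    eq : ∀ a D → 2 * (2 + a) * D + D * (2 + a) * (2 + 4 * a + a * a) ≡ (2 + a) * ((2 + a) * ((2 + a) * 1)) * D
    eq = solve-∀

module Binomial where
  open import Data.Nat
  open import Data.Nat.Properties
  open import Data.Nat.Combinatorics using (_C_; nCk+nC[k+1]≡[n+1]C[k+1]; nC1≡n)
  open import Data.Nat.Tactic.RingSolver using (solve; solve-∀)
  open import Data.List using (_∷_; [])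
  open import Relation.Binary.PropositionalEquality
  open NatBounds using (≤-by)

  0<nCk : ∀ {n k} → k ≤ n → 0 < n C k
  0<nCk {zero}  {zero}  _         = s≤s z≤n
  0<nCk {suc n} {zero}  _         = s≤s z≤n
  0<nCk {suc n} {suc k} (s≤s k≤n) = begin-strict
    0                  <⟨ 0<nCk k≤n ⟩
    n C k              ≤⟨ m≤m+n (n C k) (n C suc k) ⟩
    n C k + n C suc k  ≡⟨ nCk+nC[k+1]≡[n+1]C[k+1] n k ⟩
    suc n C suc k      ∎
    where open ≤-Reasoning

  [1+k]*[1+n]C[1+k]≡[1+n]*nCk : ∀ n k → suc k * (suc n C suc k) ≡ suc n * (n C k)
  [1+k]*[1+n]C[1+k]≡[1+n]*nCk zero    zero    = refl
  [1+k]*[1+n]C[1+k]≡[1+n]*nCk zero    (suc k) = *-zeroʳ (suc (suc k))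
  [1+k]*[1+n]C[1+k]≡[1+n]*nCk (suc n) zero    = begin
    1 * (suc (suc n) C 1)  ≡⟨ *-identityˡ _ ⟩
    suc (suc n) C 1        ≡⟨ nC1≡n (suc (suc n)) ⟩
    suc (suc n)            ≡⟨ *-identityʳ (suc (suc n)) ⟨
    suc (suc n) * 1        ∎
    where open ≡-Reasoning
  [1+k]*[1+n]C[1+k]≡[1+n]*nCk (suc n) (suc k) = begin
    suc (suc k) * (suc (suc n) C suc (suc k))  ≡⟨ cong (suc (suc k) *_) (pascal (suc n) (suc k)) ⟨
    suc (suc k) * (X + Y)                      ≡⟨ split k X Y ⟩
    suc k * X + suc (suc k) * Y + X            ≡⟨ cong₂ (λ a b → a + b + X) (absorb n k) (absorb n (suc k)) ⟩
    suc n * (n C k) + suc n * (n C suc k) + X  ≡⟨ cong (_+ X) (*-distribˡ-+ (suc n) (n C k) (n C suc k)) ⟨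
    suc n * (n C k + n C suc k) + X            ≡⟨ cong (λ a → suc n * a + X) (pascal n k) ⟩
    suc n * X + X                              ≡⟨ +-comm (suc n * X) X ⟩
    suc (suc n) * X                            ∎
    where
    open ≡-Reasoning
    pascal : ∀ n k → n C k + n C suc k ≡ suc n C suc k
    pascal = nCk+nC[k+1]≡[n+1]C[k+1]
    absorb : ∀ n k → suc k * (suc n C suc k) ≡ suc n * (n C k)
    absorb = [1+k]*[1+n]C[1+k]≡[1+n]*nCk
    X Y : ℕ
    X = suc n C suc k
    Y = suc n C suc (suc k)
    split : ∀ k x y → suc (suc k) * (x + y) ≡ suc k * x + suc (suc k) * y + x
    split = solve-∀

  [1+m]^j*[1+a]≤[a+1+j]C[1+j] : ∀ m j a → m * suc j ≤ a → suc m ^ j * suc a ≤ (a + suc j) C suc j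
  [1+m]^j*[1+a]≤[a+1+j]C[1+j] m zero a _ = begin
    1 * suc a    ≡⟨ solve (a ∷ []) ⟩
    a + 1        ≡⟨ nC1≡n (a + 1) ⟨
    (a + 1) C 1  ∎
    where open ≤-Reasoning
  [1+m]^j*[1+a]≤[a+1+j]C[1+j] m (suc j) a m[2+j]≤a rewrite +-suc a (suc j) =
    *-cancelˡ-≤ (suc (suc j)) (begin
      suc (suc j) * (suc m ^ suc j * suc a)      ≡⟨ regroup m j a (suc m ^ j) ⟩
      suc m ^ j * suc a * (suc m * suc (suc j))  ≤⟨ *-monoʳ-≤ (suc m ^ j * suc a) [1+m][2+j]≤1+N ⟩
      suc m ^ j * suc a * suc N                  ≤⟨ *-monoˡ-≤ (suc N) (induction m[1+j]≤a) ⟩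
      (N C suc j) * suc N                        ≡⟨ *-comm (N C suc j) (suc N) ⟩
      suc N * (N C suc j)                        ≡⟨ [1+k]*[1+n]C[1+k]≡[1+n]*nCk N (suc j) ⟨
      suc (suc j) * (suc N C suc (suc j))        ∎)
    where
    open ≤-Reasoning
    N : ℕ
    N = a + suc j
    induction : m * suc j ≤ a → suc m ^ j * suc a ≤ N C suc j
    induction = [1+m]^j*[1+a]≤[a+1+j]C[1+j] m j a
    regroup : ∀ m j a p → suc (suc j) * (suc m * p * suc a) ≡ p * suc a * (suc m * suc (suc j))
    regroup = solve-∀
    m[1+j]≤a : m * suc j ≤ a
    m[1+j]≤a = ≤-trans (*-monoʳ-≤ m (n≤1+n (suc j))) m[2+j]≤a
    [1+m][2+j]≤1+N : suc m * suc (suc j) ≤ suc N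
    [1+m][2+j]≤1+N = begin
      suc m * suc (suc j)            ≡⟨ +-comm (suc (suc j)) (m * suc (suc j)) ⟩
      m * suc (suc j) + suc (suc j)  ≤⟨ +-monoˡ-≤ (suc (suc j)) m[2+j]≤a ⟩
      a + suc (suc j)                ≡⟨ +-suc a (suc j) ⟩
      suc N                          ∎

  2*m^c≤[m*c]Cc : ∀ {m c} → 2 ≤ m → 3 ≤ c → 2 * m ^ c ≤ (m * c) C c
  2*m^c≤[m*c]Cc {suc m} {suc j} (s≤s 1≤m) (s≤s 2≤j) = begin
    2 * (suc m * suc m ^ j)      ≡⟨ regroup m (suc m ^ j) ⟩
    suc m ^ j * (2 * suc m)      ≤⟨ *-monoʳ-≤ (suc m ^ j) (2[1+m]≤1+m[1+j] 1≤m 2≤j) ⟩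
    suc m ^ j * suc (m * suc j)  ≤⟨ [1+m]^j*[1+a]≤[a+1+j]C[1+j] m j (m * suc j) ≤-refl ⟩
    (m * suc j + suc j) C suc j  ≡⟨ cong (_C suc j) (+-comm (m * suc j) (suc j)) ⟩
    (suc m * suc j) C suc j      ∎
    where
    open ≤-Reasoning
    regroup : ∀ m p → 2 * (suc m * p) ≡ p * (2 * suc m)
    regroup = solve-∀
    2[1+m]≤1+m[1+j] : ∀ {m j} → 1 ≤ m → 2 ≤ j → 2 * suc m ≤ suc (m * suc j)
    2[1+m]≤1+m[1+j] {suc m} {suc (suc j)} _ (s≤s (s≤s z≤n)) = ≤-by (m * j + m + j) (solve (m ∷ j ∷ []))

  2*nC2≡n*[n∸1] : ∀ n → 2 * (n C 2) ≡ n * (n ∸ 1)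
  2*nC2≡n*[n∸1] zero    = refl
  2*nC2≡n*[n∸1] (suc n) = trans ([1+k]*[1+n]C[1+k]≡[1+n]*nCk n 1) (cong (suc n *_) (nC1≡n n))

module Fractions where
  open import Data.Nat as ℕ using (suc; s≤s; z≤n)
  import Data.Nat.Properties as ℕ
  open import Data.Integer as ℤ using (ℤ; +_; +≤+; +<+)
  import Data.Integer.Properties as ℤ
  open import Data.Rational using (ℚ; _+_; _*_; _-_; _≤_; _<_; Positive; toℚᵘ)
  open import Data.Rational.Properties
  open import Data.Rational.Unnormalised as ℚᵘ using (mkℚᵘ; *≡*; *≤*; *<*)
  import Data.Rational.Unnormalised.Properties as ℚᵘ
  open import Data.Rational.Solver using (module +-*-Solver)
  open import Algebra.Bundles using (CommutativeMonoid)
  open import Algebra.Properties.CommutativeSemigroup (CommutativeMonoid.commutativeSemigroup *-1-commutativeMonoid)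
    using (xy∙z≈xz∙y; interchange)
  open import Relation.Binary.PropositionalEquality
  open +-*-Solver using (solve; _:+_; _:*_; _:-_; _:=_)

  toℚᵘ-frac : ∀ a d → toℚᵘ (frac a (suc d)) ℚᵘ.≃ mkℚᵘ (+ a) d
  toℚᵘ-frac a d = toℚᵘ-fromℚᵘ (mkℚᵘ (+ a) d)

  ι-+ : ∀ a b → ι (a ℕ.+ b) ≡ ι a + ι b
  ι-+ a b = toℚᵘ-injective (begin
    toℚᵘ (ι (a ℕ.+ b))              ≈⟨ toℚᵘ-frac (a ℕ.+ b) 0 ⟩
    mkℚᵘ (+ (a ℕ.+ b)) 0            ≈⟨ *≡* (trans (cong (ℤ._* + 1) (ℤ.pos-+ a b)) (eq (+ a) (+ b))) ⟩
    mkℚᵘ (+ a) 0 ℚᵘ.+ mkℚᵘ (+ b) 0  ≈⟨ ℚᵘ.+-cong (toℚᵘ-frac a 0) (toℚᵘ-frac b 0) ⟨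
    toℚᵘ (ι a) ℚᵘ.+ toℚᵘ (ι b)      ≈⟨ toℚᵘ-homo-+ (ι a) (ι b) ⟨
    toℚᵘ (ι a + ι b)                ∎)
    where
    open ℚᵘ.≃-Reasoning
    eq : ∀ (x y : ℤ) → (x ℤ.+ y) ℤ.* + 1 ≡ (x ℤ.* + 1 ℤ.+ y ℤ.* + 1) ℤ.* + 1
    eq x y = trans (ℤ.*-identityʳ (x ℤ.+ y))
      (sym (trans (ℤ.*-identityʳ _) (cong₂ ℤ._+_ (ℤ.*-identityʳ x) (ℤ.*-identityʳ y))))

  frac-* : ∀ a b {d e} → 0 ℕ.< d → 0 ℕ.< e → frac (a ℕ.* b) (d ℕ.* e) ≡ frac a d * frac b e
  frac-* a b {suc d} {suc e} _ _ = toℚᵘ-injective (begin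
    toℚᵘ (frac (a ℕ.* b) (suc d ℕ.* suc e))           ≈⟨ toℚᵘ-frac (a ℕ.* b) _ ⟩
    mkℚᵘ (+ (a ℕ.* b)) _                              ≡⟨ cong (λ n → mkℚᵘ n _) (ℤ.pos-* a b) ⟩
    mkℚᵘ (+ a) d ℚᵘ.* mkℚᵘ (+ b) e                    ≈⟨ ℚᵘ.*-cong (toℚᵘ-frac a d) (toℚᵘ-frac b e) ⟨
    toℚᵘ (frac a (suc d)) ℚᵘ.* toℚᵘ (frac b (suc e))  ≈⟨ toℚᵘ-homo-* (frac a (suc d)) (frac b (suc e)) ⟨
    toℚᵘ (frac a (suc d) * frac b (suc e))            ∎)
    where open ℚᵘ.≃-Reasoning

  ι-* : ∀ a b → ι (a ℕ.* b) ≡ ι a * ι b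
  ι-* a b = frac-* a b (s≤s z≤n) (s≤s z≤n)

  frac-*-ι : ∀ a {d} → 0 ℕ.< d → frac a d * ι d ≡ ι a
  frac-*-ι a {suc d} _ = toℚᵘ-injective (begin
    toℚᵘ (frac a (suc d) * ι (suc d))            ≈⟨ toℚᵘ-homo-* (frac a (suc d)) (ι (suc d)) ⟩
    toℚᵘ (frac a (suc d)) ℚᵘ.* toℚᵘ (ι (suc d))  ≈⟨ ℚᵘ.*-cong (toℚᵘ-frac a d) (toℚᵘ-frac (suc d) 0) ⟩
    mkℚᵘ (+ a) d ℚᵘ.* mkℚᵘ (+ suc d) 0           ≈⟨ *≡* eq ⟩
    mkℚᵘ (+ a) 0                                 ≈⟨ toℚᵘ-frac a 0 ⟨
    toℚᵘ (ι a)                                   ∎)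
    where
    open ℚᵘ.≃-Reasoning
    eq : (+ a ℤ.* + suc d) ℤ.* + 1 ≡ + a ℤ.* + suc (d ℕ.* 1)
    eq = trans (ℤ.*-identityʳ _) (cong (λ n → + a ℤ.* + suc n) (sym (ℕ.*-identityʳ d)))

  frac-mono-≤ : ∀ {a b z w} → 0 ℕ.< z → 0 ℕ.< w → a ℕ.* w ℕ.≤ b ℕ.* z → frac a z ≤ frac b w
  frac-mono-≤ {a} {b} {suc z} {suc w} _ _ aw≤bz = toℚᵘ-cancel-≤
    (ℚᵘ.≤-respˡ-≃ (ℚᵘ.≃-sym (toℚᵘ-frac a z)) (ℚᵘ.≤-respʳ-≃ (ℚᵘ.≃-sym (toℚᵘ-frac b w))
      (*≤* (subst₂ ℤ._≤_ (ℤ.pos-* a (suc w)) (ℤ.pos-* b (suc z)) (+≤+ aw≤bz)))))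

  frac-mono-< : ∀ {a b z w} → 0 ℕ.< z → 0 ℕ.< w → a ℕ.* w ℕ.< b ℕ.* z → frac a z < frac b w
  frac-mono-< {a} {b} {suc z} {suc w} _ _ aw<bz = toℚᵘ-cancel-<
    (ℚᵘ.<-respˡ-≃ (ℚᵘ.≃-sym (toℚᵘ-frac a z)) (ℚᵘ.<-respʳ-≃ (ℚᵘ.≃-sym (toℚᵘ-frac b w))
      (*<* (subst₂ ℤ._<_ (ℤ.pos-* a (suc w)) (ℤ.pos-* b (suc z)) (+<+ aw<bz)))))

  frac-pos : ∀ {a d} → 0 ℕ.< a → 0 ℕ.< d → Positive (frac a d)
  frac-pos {suc a} {suc d} _ _ = normalize-pos (suc a) (suc d)

  ι-mono-< : ∀ {a b} → a ℕ.< b → ι a < ι b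
  ι-mono-< {a} {b} a<b = frac-mono-< {a} {b} {1} {1} (s≤s z≤n) (s≤s z≤n)
    (subst₂ ℕ._<_ (sym (ℕ.*-identityʳ a)) (sym (ℕ.*-identityʳ b)) a<b)

  scale-* : ∀ {x S a z} n → x * ι z ≡ ι a * S → x * ι (z ℕ.* n) ≡ ι (a ℕ.* n) * S
  scale-* {x} {S} {a} {z} n e = begin
    x * ι (z ℕ.* n)  ≡⟨ cong (x *_) (ι-* z n) ⟩
    x * (ι z * ι n)  ≡⟨ *-assoc x (ι z) (ι n) ⟨
    x * ι z * ι n    ≡⟨ cong (_* ι n) e ⟩
    ι a * S * ι n    ≡⟨ xy∙z≈xz∙y (ι a) S (ι n) ⟩
    ι a * ι n * S    ≡⟨ cong (_* S) (ι-* a n) ⟨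
    ι (a ℕ.* n) * S  ∎
    where open ≡-Reasoning

  cross-< : ∀ {x y S} a z b w → Positive S →
    x * ι z ≡ ι a * S → y * ι w ≡ ι b * S → a ℕ.* w ℕ.< b ℕ.* z → x < y
  cross-< {x} {y} {S} a z b w S>0 x≡ y≡ aw<bz =
    *-cancelʳ-<-nonNeg (ι (z ℕ.* w)) {{normalize-nonNeg (z ℕ.* w) 1}} (begin-strict
      x * ι (z ℕ.* w)  ≡⟨ scale-* {x} {S} {a} {z} w x≡ ⟩
      ι (a ℕ.* w) * S  <⟨ *-monoˡ-<-pos S {{S>0}} (ι-mono-< aw<bz) ⟩
      ι (b ℕ.* z) * S  ≡⟨ scale-* {y} {S} {b} {w} z y≡ ⟨
      y * ι (w ℕ.* z)  ≡⟨ cong (λ n → y * ι n) (ℕ.*-comm w z) ⟩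
      y * ι (z ℕ.* w)  ∎)
    where open ≤-Reasoning

  scale-sq : ∀ x {T} a z → x * ι z ≡ ι a * T → sq x * ι (z ℕ.* z) ≡ ι (a ℕ.* a) * sq T
  scale-sq x {T} a z e = begin
    x * x * ι (z ℕ.* z)    ≡⟨ cong (x * x *_) (ι-* z z) ⟩
    x * x * (ι z * ι z)    ≡⟨ interchange x x (ι z) (ι z) ⟩
    (x * ι z) * (x * ι z)  ≡⟨ cong₂ _*_ e e ⟩
    (ι a * T) * (ι a * T)  ≡⟨ interchange (ι a) (ι a) T T ⟨
    ι a * ι a * (T * T)    ≡⟨ cong (_* sq T) (ι-* a a) ⟨
    ι (a ℕ.* a) * sq T     ∎
    where open ≡-Reasoning

  scale-by : ∀ x a z S → x * ι z ≡ ι a → x * S * ι z ≡ ι a * S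
  scale-by x a z S e = trans (xy∙z≈xz∙y x S (ι z)) (cong (_* S) e)

  +frac-scale : ∀ p r {D} → 0 ℕ.< D → (ι p + frac r D) * ι D ≡ ι (p ℕ.* D ℕ.+ r)
  +frac-scale p r {D} D>0 = begin
    (ι p + frac r D) * ι D      ≡⟨ *-distribʳ-+ (ι D) (ι p) (frac r D) ⟩
    ι p * ι D + frac r D * ι D  ≡⟨ cong₂ _+_ (sym (ι-* p D)) (frac-*-ι r D>0) ⟩
    ι (p ℕ.* D) + ι r           ≡⟨ ι-+ (p ℕ.* D) r ⟨
    ι (p ℕ.* D ℕ.+ r)           ∎
    where open ≡-Reasoning

  ρ-form : ∀ p q r {D} → 0 ℕ.< D →
    (ι p + frac r D) * (ι q + frac r D) * ι (D ℕ.* D) ≡ ι ((p ℕ.* D ℕ.+ r) ℕ.* (q ℕ.* D ℕ.+ r))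
  ρ-form p q r {D} D>0 = begin
    x * y * ι (D ℕ.* D)                      ≡⟨ cong (x * y *_) (ι-* D D) ⟩
    x * y * (ι D * ι D)                      ≡⟨ interchange x y (ι D) (ι D) ⟩
    (x * ι D) * (y * ι D)                    ≡⟨ cong₂ _*_ (+frac-scale p r D>0) (+frac-scale q r D>0) ⟩
    ι (p ℕ.* D ℕ.+ r) * ι (q ℕ.* D ℕ.+ r)    ≡⟨ ι-* (p ℕ.* D ℕ.+ r) (q ℕ.* D ℕ.+ r) ⟨
    ι ((p ℕ.* D ℕ.+ r) ℕ.* (q ℕ.* D ℕ.+ r))  ∎
    where
    open ≡-Reasoning
    x y : ℚ
    x = ι p + frac r D
    y = ι q + frac r D

  horner-form : ∀ a b g {D} → 0 ℕ.< D →
    (ι a + frac b D + frac g (D ℕ.* D)) * ι (D ℕ.* D) ≡ ι ((a ℕ.* D ℕ.+ b) ℕ.* D ℕ.+ g)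
  horner-form a b g {D} D>0 = begin
    (x + y) * ι (D ℕ.* D)              ≡⟨ *-distribʳ-+ (ι (D ℕ.* D)) x y ⟩
    x * ι (D ℕ.* D) + y * ι (D ℕ.* D)  ≡⟨ cong₂ _+_ (cong (x *_) (ι-* D D)) (frac-*-ι g D²>0) ⟩
    x * (ι D * ι D) + ι g              ≡⟨ cong (_+ ι g) (*-assoc x (ι D) (ι D)) ⟨
    x * ι D * ι D + ι g                ≡⟨ cong (λ z → z * ι D + ι g) (+frac-scale a b D>0) ⟩
    ι (a ℕ.* D ℕ.+ b) * ι D + ι g      ≡⟨ cong (_+ ι g) (ι-* (a ℕ.* D ℕ.+ b) D) ⟨
    ι ((a ℕ.* D ℕ.+ b) ℕ.* D) + ι g    ≡⟨ ι-+ ((a ℕ.* D ℕ.+ b) ℕ.* D) g ⟨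
    ι ((a ℕ.* D ℕ.+ b) ℕ.* D ℕ.+ g)    ∎
    where
    open ≡-Reasoning
    x y : ℚ
    x = ι a + frac b D
    y = frac g (D ℕ.* D)
    D²>0 : 0 ℕ.< D ℕ.* D
    D²>0 = ℕ.*-mono-≤ D>0 D>0

  f₀-form : ∀ {m m₁ B C E} T T₂ → ι B * T₂ ≡ ι m * T →
    2 ℕ.* C ≡ m ℕ.* m₁ → E ℕ.+ m ℕ.* m₁ ≡ 2 ℕ.* B →
    (ι m * T - ι C * T₂) * ι (2 ℕ.* B) ≡ ι (m ℕ.* E) * T
  f₀-form {m} {m₁} {B} {C} {E} T T₂ BT₂≡mT 2C≡ E≡ = begin
    (ι m * T - ι C * T₂) * ι (2 ℕ.* B)
      ≡⟨ cong ((ι m * T - ι C * T₂) *_) (ι-* 2 B) ⟩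
    (ι m * T - ι C * T₂) * (ι 2 * ι B)
      ≡⟨ expand (ι m * T) (ι C) T₂ (ι 2) (ι B) ⟩
    ι m * T * (ι 2 * ι B) - ι 2 * ι C * (ι B * T₂)
      ≡⟨ cong₂ (λ b c → ι m * T * b - c * (ι B * T₂)) (ι-* 2 B) (ι-* 2 C) ⟨
    ι m * T * ι (2 ℕ.* B) - ι (2 ℕ.* C) * (ι B * T₂)
      ≡⟨ cong₂ (λ b c → ι m * T * ι b - ι c * (ι B * T₂)) (sym E≡) 2C≡ ⟩
    ι m * T * ι (E ℕ.+ m ℕ.* m₁) - ι (m ℕ.* m₁) * (ι B * T₂)
      ≡⟨ cong₂ (λ b c → ι m * T * b - ι (m ℕ.* m₁) * c) (ι-+ E (m ℕ.* m₁)) BT₂≡mT ⟩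
    ι m * T * (ι E + ι (m ℕ.* m₁)) - ι (m ℕ.* m₁) * (ι m * T)
      ≡⟨ cancel (ι m) T (ι E) (ι (m ℕ.* m₁)) ⟩
    ι m * ι E * T
      ≡⟨ cong (_* T) (ι-* m E) ⟨
    ι (m ℕ.* E) * T
      ∎
    where
    open ≡-Reasoning
    expand : ∀ (x c y d b : ℚ) → (x - c * y) * (d * b) ≡ x * (d * b) - d * c * (b * y)
    expand = solve 5 (λ x c y d b → (x :- c :* y) :* (d :* b) := x :* (d :* b) :- d :* c :* (b :* y)) refl
    cancel : ∀ (x t e n : ℚ) → x * t * (e + n) - n * (x * t) ≡ x * e * t
    cancel = solve 4 (λ x t e n → x :* t :* (e :+ n) :- n :* (x :* t) := x :* e :* t) refl

  f₂-form : ∀ {u n B E} T → 0 ℕ.< B → E ℕ.+ n ≡ u ℕ.* B → T * (ι u - frac n B) * ι B ≡ ι E * T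
  f₂-form {u} {n} {B} {E} T B>0 E≡ = begin
    T * (ι u - frac n B) * ι B        ≡⟨ expand T (ι u) (frac n B) (ι B) ⟩
    T * (ι u * ι B - frac n B * ι B)  ≡⟨ cong₂ (λ a b → T * (a - b)) (sym (ι-* u B)) (frac-*-ι n B>0) ⟩
    T * (ι (u ℕ.* B) - ι n)           ≡⟨ cong (λ a → T * (ι a - ι n)) E≡ ⟨
    T * (ι (E ℕ.+ n) - ι n)           ≡⟨ cong (λ a → T * (a - ι n)) (ι-+ E n) ⟩
    T * (ι E + ι n - ι n)             ≡⟨ cancel T (ι E) (ι n) ⟩
    ι E * T                           ∎
    where
    open ≡-Reasoning
    expand : ∀ (t x y b : ℚ) → t * (x - y) * b ≡ t * (x * b - y * b)
    expand = solve 4 (λ t x y b → t :* (x :- y) :* b := t :* (x :* b :- y :* b)) refl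
    cancel : ∀ (t e n : ℚ) → t * (e + n - n) ≡ e * t
    cancel = solve 3 (λ t e n → t :* (e :+ n :- n) := e :* t) refl

module Theta where
  open import Data.Nat as ℕ using (ℕ; suc; _∸_; _!; s≤s; z≤n)
  import Data.Nat.Properties as ℕ
  open import Data.Nat.Combinatorics using (_C_)
  open import Data.Nat.ListAction using (product)
  open import Data.Nat.ListAction.Properties using (product≢0)
  open import Data.List using (map; upTo; applyUpTo)
  open import Data.List.Properties using (map-applyUpTo; map-cong)
  open import Data.List.Relation.Unary.All.Properties using (map⁺; applyUpTo⁺₁)
  open import Data.Rational using (_*_; Positive)
  open import Data.Rational.Properties using (*-1-commutativeMonoid)
  open import Algebra.Bundles using (CommutativeMonoid)
  open import Algebra.Properties.CommutativeSemigroup (CommutativeMonoid.commutativeSemigroup *-1-commutativeMonoid)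
    using (x∙yz≈yx∙z)
  open import Function using (id; _∘_)
  open import Relation.Binary.PropositionalEquality
  open Fractions using (frac-*; frac-*-ι; frac-pos)
  open Binomial using (0<nCk)

  k∸z≡1+k∸[1+z] : ∀ {k z} → z ℕ.< k → k ∸ z ≡ suc (k ∸ suc z)
  k∸z≡1+k∸[1+z] {k} {z} z<k = begin
    k ∸ z                 ≡⟨ ℕ.suc-pred (k ∸ z) {{ℕ.>-nonZero (ℕ.m<n⇒0<n∸m z<k)}} ⟨
    suc (ℕ.pred (k ∸ z))  ≡⟨ cong suc (ℕ.pred[m∸n]≡m∸[1+n] k z) ⟩
    suc (k ∸ suc z)       ∎
    where open ≡-Reasoning

  prodRange-step : ∀ {z k} f → z ℕ.< k → prodRange z k f ≡ f z ℕ.* prodRange (suc z) k f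
  prodRange-step {z} {k} f z<k = begin
    product (map g (upTo (k ∸ z)))             ≡⟨ cong (λ n → product (map g (upTo n))) (k∸z≡1+k∸[1+z] z<k) ⟩
    g 0 ℕ.* product (map g (applyUpTo suc n))  ≡⟨ cong₂ ℕ._*_ (cong f (ℕ.+-identityʳ z)) (cong product shift) ⟩
    f z ℕ.* prodRange (suc z) k f              ∎
    where
    open ≡-Reasoning
    n : ℕ
    n = k ∸ suc z
    g : ℕ → ℕ
    g j = f (z ℕ.+ j)
    shift : map g (applyUpTo suc n) ≡ map (λ j → f (suc z ℕ.+ j)) (upTo n)
    shift = begin
      map g (applyUpTo suc n)               ≡⟨ map-applyUpTo suc g n ⟩
      applyUpTo (g ∘ suc) n                 ≡⟨ map-applyUpTo id (g ∘ suc) n ⟨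
      map (g ∘ suc) (upTo n)                ≡⟨ map-cong (λ j → cong f (ℕ.+-suc z j)) (upTo n) ⟩
      map (λ j → f (suc z ℕ.+ j)) (upTo n)  ∎

  θ-pos : ∀ c k z → Positive (θ c k z)
  θ-pos c k z = frac-pos prodRange>0 (ℕ.1≤n! (k ∸ z))
    where
    factor≢0 : ∀ {j} → j ℕ.< k ∸ z → ℕ.NonZero (((k ∸ (z ℕ.+ j)) ℕ.* c) C c)
    factor≢0 {j} j<k∸z = ℕ.>-nonZero (0<nCk (ℕ.m≤n*m c (k ∸ (z ℕ.+ j)) {{ℕ.>-nonZero k∸[z+j]>0}}))
      where
      k∸[z+j]>0 : 0 ℕ.< k ∸ (z ℕ.+ j)
      k∸[z+j]>0 = subst (0 ℕ.<_) (ℕ.∸-+-assoc k z j) (ℕ.m<n⇒0<n∸m j<k∸z)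
    prodRange>0 : 0 ℕ.< prodRange z k (λ i → ((k ∸ i) ℕ.* c) C c)
    prodRange>0 = ℕ.>-nonZero⁻¹ _ {{product≢0 (map⁺ (applyUpTo⁺₁ id (k ∸ z) factor≢0))}}

  θ-step : ∀ c k z → z ℕ.< k → ι (k ∸ z) * θ c k z ≡ ι (((k ∸ z) ℕ.* c) C c) * θ c k (suc z)
  θ-step c k z z<k = begin
    ι (k ∸ z) * θ c k z                           ≡⟨ cong₂ _*_ (cong ι k∸z≡1+n) θ-unfold ⟩
    ι (suc n) * (frac F (suc n) * θ c k (suc z))  ≡⟨ x∙yz≈yx∙z (ι (suc n)) (frac F (suc n)) (θ c k (suc z)) ⟩
    frac F (suc n) * ι (suc n) * θ c k (suc z)    ≡⟨ cong (_* θ c k (suc z)) (frac-*-ι F (s≤s z≤n)) ⟩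
    ι F * θ c k (suc z)                           ∎
    where
    open ≡-Reasoning
    n F : ℕ
    n = k ∸ suc z
    F = ((k ∸ z) ℕ.* c) C c
    k∸z≡1+n : k ∸ z ≡ suc n
    k∸z≡1+n = k∸z≡1+k∸[1+z] z<k
    θ-unfold : θ c k z ≡ frac F (suc n) * θ c k (suc z)
    θ-unfold = trans (cong₂ frac (prodRange-step (λ i → ((k ∸ i) ℕ.* c) C c) z<k) (cong _! k∸z≡1+n))
                     (frac-* F (prodRange (suc z) k (λ i → ((k ∸ i) ℕ.* c) C c)) (s≤s z≤n) (ℕ.1≤n! n))

module ClearedForms where
  open import Data.Nat
  open import Data.Nat.Properties
  open import Data.Nat.Tactic.RingSolver using (solve-∀; solve)
  open import Data.List using (_∷_; [])
  open import Data.Sum using (_⊎_; inj₁; inj₂)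
  open import Relation.Binary.PropositionalEquality
  open NatBounds

  -- With ρ = 3s/D, (p + ρ)(q + ρ) = ρ-num D s p q / D², and h₄-num D s A / D² is the first factor
  -- of h₄ once 12s·m³/B is replaced by 12s/D. Below-f₀² m s D L says L/D² < m² − (m−1)/D and
  -- Below-f₂² s u D L says L/D² < u² − su/D: the lower bounds for f₀²/θ² and f₂²/θ².
  ρ-num : ℕ → ℕ → ℕ → ℕ → ℕ
  ρ-num D s p q = (p * D + 3 * s) * (q * D + 3 * s)

  h₄-num : ℕ → ℕ → ℕ → ℕ
  h₄-num D s A = (A * D + 12 * s) * D + 9 * s ^ 2

  Below-f₀² : ℕ → ℕ → ℕ → ℕ → Set
  Below-f₀² m s D L = L + (m ∸ 1) * D < m * m * (D * D)

  Below-f₂² : ℕ → ℕ → ℕ → ℕ → Set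
  Below-f₂² s u D L = L + s * u * D < u * u * (D * D)

  record Cleared (t m m₁ q D : ℕ) : Set where
    field
      for-h₁ : Below-f₀² m (t + 1) D (ρ-num D (t + 1) ((t + 1) * m) 1)
             ⊎ Below-f₂² (t + 1) (t + 2) D (ρ-num D (t + 1) ((t + 1) * m) 1)
      for-h₂ : Below-f₀² m (t + 1) D (ρ-num D (t + 1) q 2) ⊎ Below-f₂² (t + 1) (t + 2) D (ρ-num D (t + 1) q 2)
      for-h₃ : Below-f₀² m (t + 1) D (ρ-num D (t + 1) m m₁)
      for-h₄ : Below-f₂² (t + 1) (t + 2) D (h₄-num D (t + 1) ((t + 2) ^ 2 ∸ 1))

  cleared-h₃ : ∀ {s m₁ D} → 3 * s * (3 * s) < 2 * D → 3 * s * (suc m₁ + m₁) + m₁ + 2 ≤ 1 * D →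
    Below-f₀² (suc m₁) s D (ρ-num D s (suc m₁) m₁)
  cleared-h₃ {s} {m₁} r²<2D β+2≤D = ρ-margin-< (suc m₁) m₁ 1 m[m-1]+1≤m² β+2≤D r²<2D
    where
    m[m-1]+1≤m² : suc m₁ * m₁ + 1 ≤ suc m₁ * suc m₁
    m[m-1]+1≤m² = ≤-by m₁ (solve (m₁ ∷ []))

  [t+2]²∸1≡[t+1][t+3] : ∀ t → (t + 2) ^ 2 ∸ 1 ≡ (t + 1) * (t + 3)
  [t+2]²∸1≡[t+1][t+3] t = cong (_∸ 1) (eq t)
    where
    eq : ∀ t → (t + 2) * ((t + 2) * 1) ≡ suc ((t + 1) * (t + 3))
    eq = solve-∀

  cleared-h₄ : ∀ {t D} → 3 * (t + 1) * (3 * (t + 1)) < 2 * D → 12 * (t + 1) + (t + 1) * (t + 2) + 2 ≤ 1 * D →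
    Below-f₂² (t + 1) (t + 2) D (h₄-num D (t + 1) ((t + 2) ^ 2 ∸ 1))
  cleared-h₄ {t} {D} r²<2D β+2≤D rewrite [t+2]²∸1≡[t+1][t+3] t = begin-strict
    ((t + 1) * (t + 3) * D + 12 * (t + 1)) * D + 9 * ((t + 1) * ((t + 1) * 1)) + (t + 1) * (t + 2) * D
      ≡⟨ solve (t ∷ D ∷ []) ⟩
    (t + 1) * (t + 3) * (D * D) + (12 * (t + 1) + (t + 1) * (t + 2)) * D + 3 * (t + 1) * (3 * (t + 1))
      <⟨ margin-< ((t + 1) * (t + 3)) 1 A+1≤u² β+2≤D r²<2D ⟩
    (t + 2) * (t + 2) * (D * D)
      ∎
    where
    open ≤-Reasoning
    A+1≤u² : (t + 1) * (t + 3) + 1 ≤ (t + 2) * (t + 2)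
    A+1≤u² = ≤-reflexive (solve (t ∷ []))

  module Bounds-t+1<m where
    γ-bound : ∀ n → 3 * n * (3 * n) < 2 * (2 * (suc n * suc n * suc n))
    γ-bound n = ≤-by (3 + 12 * n + 3 * n * n + 4 * n * n * n) (solve (n ∷ []))

    β₁-bound : ∀ n → 3 * n * (n * suc n + 1) + n + 2 ≤ suc n * (2 * (suc n * suc n * suc n))
    β₁-bound n = ≤-by (4 * n + 9 * n * n + 5 * n * n * n + 2 * n * n * n * n) (solve (n ∷ []))

    P₂-bound : ∀ {n} → 2 ≤ n → (n + n) * 2 + 1 ≤ suc n * suc n
    P₂-bound {suc (suc b)} (s≤s (s≤s z≤n)) = ≤-by (2 * b + b * b) (solve (b ∷ []))

    β₂-bound : ∀ {n} → 1 ≤ n → 3 * n * (n + n + 2) + n + 2 ≤ 2 * (suc n * suc n * suc n)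
    β₂-bound {suc b} _ = ≤-by (1 + 5 * b + 6 * b * b + 2 * b * b * b) (solve (b ∷ []))

    β₃-bound : ∀ n → 3 * n * (suc n + n) + n + 2 ≤ 2 * (suc n * suc n * suc n)
    β₃-bound n = ≤-by (2 * n + 2 * n * n * n) (solve (n ∷ []))

    β₄-bound : ∀ {n} → 1 ≤ n → 12 * n + n * (n + 1) + 2 ≤ 2 * (suc n * suc n * suc n)
    β₄-bound {suc b} _ = ≤-by (9 * b + 11 * b * b + 2 * b * b * b) (solve (b ∷ []))

  -- Every bound below is monotone in s = t + 1 ≤ m₁, so it suffices to check it at s = m₁.
  cleared-t+1<m : ∀ {t m m₁ q D} → m ≡ suc m₁ → q ≡ m + t → 1 ≤ t →
    t + 1 < m → 2 * (m * m * m) ≤ D → Cleared t m m₁ q D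
  cleared-t+1<m {t} {m₁ = n} {q} {D} refl refl 1≤t (s≤s s≤n) D≥ = record
    { for-h₁ = inj₁ (ρ-margin-< (s * m) 1 m P₁+m≤m² β₁+2≤mD γ<2D)
    ; for-h₂ = inj₁ (ρ-margin-< q 2 1 P₂+1≤m² β₂+2≤D γ<2D)
    ; for-h₃ = cleared-h₃ {s} {n} γ<2D β₃+2≤D
    ; for-h₄ = cleared-h₄ {t} γ<2D β₄+2≤D
    }
    where
    open ≤-Reasoning
    open Bounds-t+1<m
    s m : ℕ
    s = t + 1
    m = suc n
    2≤n : 2 ≤ n
    2≤n = ≤-trans (+-monoˡ-≤ 1 1≤t) s≤n
    1≤n : 1 ≤ n
    1≤n = ≤-trans (s≤s z≤n) 2≤n
    q≤n+n : suc n + t ≤ n + n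
    q≤n+n = begin
      suc n + t    ≡⟨ solve (n ∷ t ∷ []) ⟩
      n + (t + 1)  ≤⟨ +-monoʳ-≤ n s≤n ⟩
      n + n        ∎
    ≤1*D : ∀ {x} → x ≤ 2 * (m * m * m) → x ≤ 1 * D
    ≤1*D x≤ = ≤-trans x≤ (≤-trans D≥ (≤-reflexive (sym (*-identityˡ D))))
    γ<2D : 3 * s * (3 * s) < 2 * D
    γ<2D = begin-strict
      3 * s * (3 * s)        ≤⟨ *-mono-≤ (*-monoʳ-≤ 3 s≤n) (*-monoʳ-≤ 3 s≤n) ⟩
      3 * n * (3 * n)        <⟨ γ-bound n ⟩
      2 * (2 * (m * m * m))  ≤⟨ *-monoʳ-≤ 2 D≥ ⟩
      2 * D                  ∎
    P₁+m≤m² : s * m * 1 + m ≤ m * m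
    P₁+m≤m² = begin
      (t + 1) * suc n * 1 + suc n  ≡⟨ solve (t ∷ n ∷ []) ⟩
      suc (t + 1) * suc n          ≤⟨ *-monoˡ-≤ m (s≤s s≤n) ⟩
      m * m                        ∎
    β₁+2≤mD : 3 * s * (s * m + 1) + n + 2 ≤ m * D
    β₁+2≤mD = begin
      3 * s * (s * m + 1) + n + 2
        ≤⟨ +-monoˡ-≤ 2 (+-monoˡ-≤ n (*-mono-≤ (*-monoʳ-≤ 3 s≤n) (+-monoˡ-≤ 1 (*-monoˡ-≤ m s≤n)))) ⟩
      3 * n * (n * m + 1) + n + 2
        ≤⟨ β₁-bound n ⟩
      m * (2 * (m * m * m))
        ≤⟨ *-monoʳ-≤ m D≥ ⟩
      m * D
        ∎
    P₂+1≤m² : q * 2 + 1 ≤ m * m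
    P₂+1≤m² = ≤-trans (+-monoˡ-≤ 1 (*-monoˡ-≤ 2 q≤n+n)) (P₂-bound 2≤n)
    β₂+2≤D : 3 * s * (q + 2) + n + 2 ≤ 1 * D
    β₂+2≤D = ≤1*D (≤-trans
      (+-monoˡ-≤ 2 (+-monoˡ-≤ n (*-mono-≤ (*-monoʳ-≤ 3 s≤n) (+-monoˡ-≤ 2 q≤n+n)))) (β₂-bound 1≤n))
    β₃+2≤D : 3 * s * (m + n) + n + 2 ≤ 1 * D
    β₃+2≤D = ≤1*D (≤-trans
      (+-monoˡ-≤ 2 (+-monoˡ-≤ n (*-monoˡ-≤ (m + n) (*-monoʳ-≤ 3 s≤n)))) (β₃-bound n))
    β₄+2≤D : 12 * s + s * (t + 2) + 2 ≤ 1 * D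
    β₄+2≤D = ≤1*D (≤-trans
      (+-monoˡ-≤ 2 (+-mono-≤ (*-monoʳ-≤ 12 s≤n) (*-mono-≤ s≤n u≤n+1))) (β₄-bound 1≤n))
      where
      u≤n+1 : t + 2 ≤ n + 1
      u≤n+1 = ≤-trans (≤-reflexive (sym (+-assoc t 1 1))) (+-monoˡ-≤ 1 s≤n)

  module Bounds-m≤t+1 where
    γ-bound : ∀ b → 3 * (suc b + 1) * (3 * (suc b + 1)) < 2 * (32 * (suc b * suc b * suc b * suc b))
    γ-bound b = ≤-by (27 + 220 * b + 375 * b * b + 256 * b * b * b + 64 * b * b * b * b) (solve (b ∷ []))

    P₁-bound : ∀ t → (t + 1) * (t + 1) * 1 + 2 ≤ (t + 2) * (t + 2)
    P₁-bound t = ≤-by (1 + 2 * t) (solve (t ∷ []))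

    β₁-bound : ∀ b → let s = suc b + 1 in
      3 * s * (s * s + 1) + s * (suc b + 2) + 2 ≤ 2 * (32 * (suc b * suc b * suc b * suc b))
    β₁-bound b = ≤-by (26 + 212 * b + 365 * b * b + 253 * b * b * b + 64 * b * b * b * b) (solve (b ∷ []))

    P₂-bound : ∀ t → (t + 1 + t) * 2 + 2 ≤ (t + 2) * (t + 2)
    P₂-bound t = ≤-by (t * t) (solve (t ∷ []))

    β₂-bound : ∀ b → let s = suc b + 1 in
      3 * s * (s + suc b + 2) + s * (suc b + 2) + 2 ≤ 2 * (32 * (suc b * suc b * suc b * suc b))
    β₂-bound b = ≤-by (26 + 224 * b + 377 * b * b + 256 * b * b * b + 64 * b * b * b * b) (solve (b ∷ []))

    β₃-bound : ∀ b → 3 * (suc b + 1) * (suc b + 1 + suc b) + suc b + 2 ≤ 32 * (suc b * suc b * suc b * suc b)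
    β₃-bound b = ≤-by (11 + 106 * b + 186 * b * b + 128 * b * b * b + 32 * b * b * b * b) (solve (b ∷ []))

    β₄-bound : ∀ b → 12 * (suc b + 1) + (suc b + 1) * (suc b + 2) + 2 ≤ 32 * (suc b * suc b * suc b * suc b)
    β₄-bound b = ≤-by (111 * b + 191 * b * b + 128 * b * b * b + 32 * b * b * b * b) (solve (b ∷ []))

  -- Here the bounds are monotone in m ≤ t + 1, so it suffices to check them at m = t + 1.
  cleared-m≤t+1 : ∀ {t m m₁ q D} → m ≡ suc m₁ → q ≡ m + t → 1 ≤ t →
    m ≤ t + 1 → 32 * (t * t * t * t) ≤ D → Cleared t m m₁ q D
  cleared-m≤t+1 {suc b} {m₁ = n} {q} {D} refl refl (s≤s z≤n) m≤s D≥ = record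
    { for-h₁ = inj₂ (ρ-margin-< (s * m) 1 2 {D = D} P₁+2≤u² β₁+2≤2D γ<2D)
    ; for-h₂ = inj₂ (ρ-margin-< q 2 2 {D = D} P₂+2≤u² β₂+2≤2D γ<2D)
    ; for-h₃ = cleared-h₃ {s} {n} γ<2D β₃+2≤D
    ; for-h₄ = cleared-h₄ {t} γ<2D β₄+2≤D
    }
    where
    open Bounds-m≤t+1
    t s u m : ℕ
    t = suc b
    s = t + 1
    u = t + 2
    m = suc n
    n≤t : n ≤ t
    n≤t = ≤-pred (≤-trans m≤s (≤-reflexive (+-comm t 1)))
    q≤s+t : q ≤ s + t
    q≤s+t = +-monoˡ-≤ t m≤s
    32t⁴≤1*D : 32 * (t * t * t * t) ≤ 1 * D
    32t⁴≤1*D = ≤-trans D≥ (≤-reflexive (sym (*-identityˡ D)))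
    γ<2D : 3 * s * (3 * s) < 2 * D
    γ<2D = <-≤-trans (γ-bound b) (*-monoʳ-≤ 2 D≥)
    P₁+2≤u² : s * m * 1 + 2 ≤ u * u
    P₁+2≤u² = ≤-trans (+-monoˡ-≤ 2 (*-monoˡ-≤ 1 (*-monoʳ-≤ s m≤s))) (P₁-bound t)
    β₁+2≤2D : 3 * s * (s * m + 1) + s * u + 2 ≤ 2 * D
    β₁+2≤2D = ≤-trans
      (+-monoˡ-≤ 2 (+-monoˡ-≤ (s * u) (*-monoʳ-≤ (3 * s) (+-monoˡ-≤ 1 (*-monoʳ-≤ s m≤s)))))
                      (≤-trans (β₁-bound b) (*-monoʳ-≤ 2 D≥))
    P₂+2≤u² : q * 2 + 2 ≤ u * u
    P₂+2≤u² = ≤-trans (+-monoˡ-≤ 2 (*-monoˡ-≤ 2 q≤s+t)) (P₂-bound t)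
    β₂+2≤2D : 3 * s * (q + 2) + s * u + 2 ≤ 2 * D
    β₂+2≤2D = ≤-trans (+-monoˡ-≤ 2 (+-monoˡ-≤ (s * u) (*-monoʳ-≤ (3 * s) (+-monoˡ-≤ 2 q≤s+t))))
                      (≤-trans (β₂-bound b) (*-monoʳ-≤ 2 D≥))
    β₃+2≤D : 3 * s * (m + n) + n + 2 ≤ 1 * D
    β₃+2≤D = ≤-trans (+-monoˡ-≤ 2 (+-mono-≤ (*-monoʳ-≤ (3 * s) (+-mono-≤ m≤s n≤t)) n≤t))
                     (≤-trans (β₃-bound b) 32t⁴≤1*D)
    β₄+2≤D : 12 * s + s * u + 2 ≤ 1 * D
    β₄+2≤D = ≤-trans (β₄-bound b) 32t⁴≤1*D

module Comparison where
  open import Data.Nat as ℕ using (ℕ; _∸_; _^_; s≤s; z≤n)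
  import Data.Nat.Properties as ℕ
  open import Data.Nat.Combinatorics using (_C_)
  open import Data.Rational using (ℚ; _+_; _*_; _-_; _≤_; _<_; _⊔_; Positive)
  open import Data.Rational.Properties
    using ( pos*pos⇒pos; pos⇒nonNeg; <-≤-trans; p≤p⊔q; p≤q⊔p
          ; *-monoʳ-≤-nonNeg; +-monoˡ-≤; +-monoʳ-≤; module ≤-Reasoning)
  open import Data.Sum using (_⊎_; inj₁; inj₂)
  open import Relation.Binary.PropositionalEquality
  open Fractions
  open NatBounds using (f₀-clear; f₂-clear; m*m≤m^3*D; 2*m*D≤m^3*D)
  open ClearedForms using (ρ-num; h₄-num; Below-f₀²; Below-f₂²)
  open Binomial using (2*nC2≡n*[n∸1])

  module Reduction {T T₂ : ℚ} {m s u D B : ℕ}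
    (T>0 : Positive T) (BT₂≡mT : ι B * T₂ ≡ ι m * T)
    (2≤m : 2 ℕ.≤ m) (s≤u : s ℕ.≤ u) (D>0 : 0 ℕ.< D) (m³D≤B : m ^ 3 ℕ.* D ℕ.≤ B) where

    f₀′ f₂′ : ℚ
    f₀′ = ι m * T - ι (m C 2) * T₂
    f₂′ = T * (ι u - frac (s ℕ.* m) B)

    private
      m*m≤B : m ℕ.* m ℕ.≤ B
      m*m≤B = ℕ.≤-trans (m*m≤m^3*D 2≤m D>0) m³D≤B

      m>0 : 0 ℕ.< m
      m>0 = ℕ.≤-trans (s≤s z≤n) 2≤m

      B>0 : 0 ℕ.< B
      B>0 = ℕ.≤-trans (ℕ.*-mono-≤ m>0 m>0) m*m≤B

      2mD≤B : 2 ℕ.* m ℕ.* D ℕ.≤ B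
      2mD≤B = ℕ.≤-trans (2*m*D≤m^3*D D 2≤m) m³D≤B

      E₀ E₂ : ℕ
      E₀ = 2 ℕ.* B ∸ m ℕ.* (m ∸ 1)
      E₂ = u ℕ.* B ∸ s ℕ.* m

      E₀-eq : E₀ ℕ.+ m ℕ.* (m ∸ 1) ≡ 2 ℕ.* B
      E₀-eq = ℕ.m∸n+n≡m (ℕ.≤-trans (ℕ.*-monoʳ-≤ m (ℕ.m∸n≤m m 1)) (ℕ.≤-trans m*m≤B (ℕ.m≤n*m B 2)))

      E₂-eq : E₂ ℕ.+ s ℕ.* m ≡ u ℕ.* B
      E₂-eq = ℕ.m∸n+n≡m (ℕ.*-mono-≤ s≤u (ℕ.≤-trans (ℕ.m≤m*n m m {{ℕ.>-nonZero m>0}}) m*m≤B))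

      T²>0 : Positive (sq T)
      T²>0 = pos*pos⇒pos T {{T>0}} T {{T>0}}

      f₀²-scaled : sq f₀′ * ι (2 ℕ.* B ℕ.* (2 ℕ.* B)) ≡ ι (m ℕ.* E₀ ℕ.* (m ℕ.* E₀)) * sq T
      f₀²-scaled = scale-sq f₀′ (m ℕ.* E₀) (2 ℕ.* B)
        (f₀-form {m} {m ∸ 1} {B} {m C 2} {E₀} T T₂ BT₂≡mT (2*nC2≡n*[n∸1] m) E₀-eq)

      f₂²-scaled : sq f₂′ * ι (B ℕ.* B) ≡ ι (E₂ ℕ.* E₂) * sq T
      f₂²-scaled = scale-sq f₂′ E₂ B (f₂-form {u} {s ℕ.* m} {B} {E₂} T B>0 E₂-eq)

      h-scaled : ∀ p q → (ι p + frac (3 ℕ.* s) D) * (ι q + frac (3 ℕ.* s) D) * sq T * ι (D ℕ.* D)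
                         ≡ ι (ρ-num D s p q) * sq T
      h-scaled p q = scale-by ((ι p + frac (3 ℕ.* s) D) * (ι q + frac (3 ℕ.* s) D))
        (ρ-num D s p q) (D ℕ.* D) (sq T) (ρ-form p q (3 ℕ.* s) D>0)

    h<f₀² : ∀ p q → Below-f₀² m s D (ρ-num D s p q) →
      (ι p + frac (3 ℕ.* s) D) * (ι q + frac (3 ℕ.* s) D) * sq T < sq f₀′
    h<f₀² p q below =
      cross-< (ρ-num D s p q) (D ℕ.* D) (m ℕ.* E₀ ℕ.* (m ℕ.* E₀)) (2 ℕ.* B ℕ.* (2 ℕ.* B)) T²>0 (h-scaled p q) f₀²-scaled
        (f₀-clear {m} {m ∸ 1} {B} {D} {E₀} {ρ-num D s p q} E₀-eq m³D≤B B>0 below)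

    h<f₂² : ∀ p q → Below-f₂² s u D (ρ-num D s p q) →
      (ι p + frac (3 ℕ.* s) D) * (ι q + frac (3 ℕ.* s) D) * sq T < sq f₂′
    h<f₂² p q below =
      cross-< (ρ-num D s p q) (D ℕ.* D) (E₂ ℕ.* E₂) (B ℕ.* B) T²>0 (h-scaled p q) f₂²-scaled
        (f₂-clear {m} {s} {u} {B} {D} {E₂} {ρ-num D s p q} E₂-eq 2mD≤B B>0 below)

    h<f₀²⊔f₂² : ∀ p q → Below-f₀² m s D (ρ-num D s p q) ⊎ Below-f₂² s u D (ρ-num D s p q) →
      (ι p + frac (3 ℕ.* s) D) * (ι q + frac (3 ℕ.* s) D) * sq T < sq f₀′ ⊔ sq f₂′
    h<f₀²⊔f₂² p q (inj₁ below) = <-≤-trans (h<f₀² p q below) (p≤p⊔q (sq f₀′) (sq f₂′))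
    h<f₀²⊔f₂² p q (inj₂ below) = <-≤-trans (h<f₂² p q below) (p≤q⊔p (sq f₀′) (sq f₂′))

    h₄<f₂² : ∀ A E → E ≡ D ℕ.* D → Below-f₂² s u D (h₄-num D s A) →
      (ι A + frac (12 ℕ.* s ℕ.* m ^ 3) B + frac (9 ℕ.* s ^ 2) E) * sq T < sq f₂′
    h₄<f₂² A _ refl below = begin-strict
      (ι A + frac (12 ℕ.* s ℕ.* m ^ 3) B + frac (9 ℕ.* s ^ 2) (D ℕ.* D)) * sq T
        ≤⟨ *-monoʳ-≤-nonNeg (sq T) {{pos⇒nonNeg (sq T) {{T²>0}}}}
             (+-monoˡ-≤ (frac (9 ℕ.* s ^ 2) (D ℕ.* D)) (+-monoʳ-≤ (ι A) m³/B≤1/D)) ⟩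
      (ι A + frac (12 ℕ.* s) D + frac (9 ℕ.* s ^ 2) (D ℕ.* D)) * sq T
        <⟨ cross-< (h₄-num D s A) (D ℕ.* D) (E₂ ℕ.* E₂) (B ℕ.* B) T²>0 h₄-scaled f₂²-scaled
             (f₂-clear {m} {s} {u} {B} {D} {E₂} {h₄-num D s A} E₂-eq 2mD≤B B>0 below) ⟩
      sq f₂′
        ∎
      where
      open ≤-Reasoning
      m³/B≤1/D : frac (12 ℕ.* s ℕ.* m ^ 3) B ≤ frac (12 ℕ.* s) D
      m³/B≤1/D = frac-mono-≤ B>0 D>0
        (ℕ.≤-trans (ℕ.≤-reflexive (ℕ.*-assoc (12 ℕ.* s) (m ^ 3) D)) (ℕ.*-monoʳ-≤ (12 ℕ.* s) m³D≤B))
      h₄-scaled : (ι A + frac (12 ℕ.* s) D + frac (9 ℕ.* s ^ 2) (D ℕ.* D)) * sq T * ι (D ℕ.* D)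
                  ≡ ι (h₄-num D s A) * sq T
      h₄-scaled = scale-by (ι A + frac (12 ℕ.* s) D + frac (9 ℕ.* s ^ 2) (D ℕ.* D))
        (h₄-num D s A) (D ℕ.* D) (sq T) (horner-form A (12 ℕ.* s) (9 ℕ.* s ^ 2) D>0)

module Exponents where
  open import Data.Nat
  open import Data.Nat.Properties
  open import Data.Nat.Combinatorics using (_C_)
  open import Data.Nat.Tactic.RingSolver using (solve-∀; solve)
  open import Data.List using (_∷_; [])
  open import Relation.Binary.PropositionalEquality
  open Binomial using (2*m^c≤[m*c]Cc)

  m^3*[2*m^[c∸3]]≤[m*c]Cc : ∀ {m c} → 2 ≤ m → 3 ≤ c → m ^ 3 * (2 * m ^ (c ∸ 3)) ≤ (m * c) C c
  m^3*[2*m^[c∸3]]≤[m*c]Cc {m} {c@(suc (suc (suc n)))} 2≤m (s≤s (s≤s (s≤s _))) = begin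
    m ^ 3 * (2 * m ^ n)  ≡⟨ regroup m (m ^ n) ⟩
    2 * m ^ c            ≤⟨ 2*m^c≤[m*c]Cc 2≤m (s≤s (s≤s (s≤s z≤n))) ⟩
    (m * c) C c          ∎
    where
    open ≤-Reasoning
    regroup : ∀ m p → m * (m * (m * 1)) * (2 * p) ≡ 2 * (m * (m * (m * p)))
    regroup = solve-∀

  2*m³≤2*m^[c∸3] : ∀ {m c} → 1 ≤ m → 6 ≤ c → 2 * (m * m * m) ≤ 2 * m ^ (c ∸ 3)
  2*m³≤2*m^[c∸3] {m} {c} 1≤m 6≤c = *-monoʳ-≤ 2 (begin
    m * m * m          ≡⟨ solve (m ∷ []) ⟩
    m * (m * (m * 1))  ≤⟨ ^-monoʳ-≤ m {{>-nonZero 1≤m}} (∸-monoˡ-≤ 3 6≤c) ⟩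
    m ^ (c ∸ 3)        ∎)
    where open ≤-Reasoning

  32*t⁴≤2*m^[c∸3] : ∀ {t m c} → 2 ≤ m → 7 ≤ c → t ^ 4 ≤ 2 ^ (c ∸ 7) →
    32 * (t * t * t * t) ≤ 2 * m ^ (c ∸ 3)
  32*t⁴≤2*m^[c∸3] {t} {m} {c@(suc (suc (suc (suc (suc (suc (suc n)))))))} 2≤m
    (s≤s (s≤s (s≤s (s≤s (s≤s (s≤s (s≤s _))))))) t⁴≤2^n = begin
    32 * (t * t * t * t)            ≡⟨ solve (t ∷ []) ⟩
    32 * (t * (t * (t * (t * 1))))  ≤⟨ *-monoʳ-≤ 32 t⁴≤2^n ⟩
    32 * 2 ^ n                      ≡⟨ regroup (2 ^ n) ⟩
    2 * 2 ^ (4 + n)                 ≤⟨ *-monoʳ-≤ 2 (^-monoˡ-≤ (4 + n) 2≤m) ⟩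
    2 * m ^ (c ∸ 3)                 ∎
    where
    open ≤-Reasoning
    regroup : ∀ p → 32 * p ≡ 2 * (2 * (2 * (2 * (2 * p))))
    regroup = solve-∀

  4*m^[2c∸6]≡[2*m^[c∸3]]² : ∀ {m c} → 3 ≤ c →
    4 * m ^ (2 * c ∸ 6) ≡ 2 * m ^ (c ∸ 3) * (2 * m ^ (c ∸ 3))
  4*m^[2c∸6]≡[2*m^[c∸3]]² {m} {c@(suc (suc (suc n)))} (s≤s (s≤s (s≤s _))) = begin
    4 * m ^ (2 * c ∸ 6)      ≡⟨ cong (λ e → 4 * m ^ (e ∸ 6)) (2[3+n]≡6+[n+n] n) ⟩
    4 * m ^ (n + n)          ≡⟨ cong (4 *_) (^-distribˡ-+-* m n n) ⟩
    4 * (m ^ n * m ^ n)      ≡⟨ regroup (m ^ n) ⟩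
    2 * m ^ n * (2 * m ^ n)  ∎
    where
    open ≡-Reasoning
    2[3+n]≡6+[n+n] : ∀ n → 2 * (3 + n) ≡ 6 + (n + n)
    2[3+n]≡6+[n+n] = solve-∀
    regroup : ∀ p → 4 * (p * p) ≡ 2 * p * (2 * p)
    regroup = solve-∀

open import Data.Nat using (ℕ; _≤_; _+_; _*_; _^_; _∸_)

module Instance (c k t : ℕ) (1≤t : 1 ≤ t) (6≤c : 6 ≤ c) (t+3≤k : t + 3 ≤ k) where
  open import Data.Nat using (suc; _<_; _<?_; s≤s; z≤n; >-nonZero)
  open import Data.Nat.Properties
  open import Data.Nat.Combinatorics using (_C_)
  open import Data.Nat.Tactic.RingSolver using (solve; solve-∀)
  open import Data.List using (_∷_; [])
  open import Data.Product using (_×_; _,_)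
  open import Data.Sum using (_⊎_; inj₁; inj₂)
  open import Data.Rational as ℚ using ()
  open import Relation.Nullary using (yes; no)
  open import Relation.Binary.PropositionalEquality
  open Theta using (θ-step)
  open ClearedForms using (Cleared; cleared-t+1<m; cleared-m≤t+1)
  open Exponents

  m D B : ℕ
  m = k ∸ t ∸ 1
  D = 2 * m ^ (c ∸ 3)
  B = (m * c) C c

  private
    3≤c : 3 ≤ c
    3≤c = ≤-trans (s≤s (s≤s (s≤s z≤n))) 6≤c

    3≤k∸t : 3 ≤ k ∸ t
    3≤k∸t = m+n≤o⇒m≤o∸n 3 (≤-trans (≤-reflexive (+-comm 3 t)) t+3≤k)

    m≡1+m₁ : m ≡ suc (k ∸ t ∸ 2)
    m≡1+m₁ = x∸1≡1+x∸2 (≤-trans (n≤1+n 2) 3≤k∸t)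
      where
      x∸1≡1+x∸2 : ∀ {x} → 2 ≤ x → x ∸ 1 ≡ suc (x ∸ 2)
      x∸1≡1+x∸2 {suc (suc x)} (s≤s (s≤s z≤n)) = refl

    k∸1≡m+t : k ∸ 1 ≡ m + t
    k∸1≡m+t = trans (cong (_∸ 1) (sym (m∸n+n≡m (m+n≤o⇒m≤o t t+3≤k))))
                    (+-∸-comm t (≤-trans (s≤s z≤n) 3≤k∸t))

  2≤m : 2 ≤ m
  2≤m = ∸-monoˡ-≤ 1 3≤k∸t

  private
    1≤m : 1 ≤ m
    1≤m = ≤-trans (s≤s z≤n) 2≤m

  t+1≤t+2 : t + 1 ≤ t + 2
  t+1≤t+2 = +-monoʳ-≤ t (n≤1+n 1)

  D>0 : 0 < D
  D>0 = ≤-trans (m^n>0 m {{>-nonZero 1≤m}} (c ∸ 3)) (m≤n*m (m ^ (c ∸ 3)) 2)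

  m³D≤B : m ^ 3 * D ≤ B
  m³D≤B = m^3*[2*m^[c∸3]]≤[m*c]Cc 2≤m 3≤c

  4m^[2c∸6]≡D*D : 4 * m ^ (2 * c ∸ 6) ≡ D * D
  4m^[2c∸6]≡D*D = 4*m^[2c∸6]≡[2*m^[c∸3]]² 3≤c

  Bθ₂≡mθ₁ : ι B ℚ.* θ c k (suc (suc t)) ≡ ι m ℚ.* θ c k (suc t)
  Bθ₂≡mθ₁ = sym (subst (λ x → ι x ℚ.* θ c k (suc t) ≡ ι ((x * c) C c) ℚ.* θ c k (suc (suc t)))
                       (sym k∸t∸1≡k∸[1+t]) (θ-step c k (suc t) 1+t<k))
    where
    k∸t∸1≡k∸[1+t] : k ∸ t ∸ 1 ≡ k ∸ suc t
    k∸t∸1≡k∸[1+t] = trans (∸-+-assoc k t 1) (cong (k ∸_) (+-comm t 1))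
    1+t<k : suc t < k
    1+t<k = begin
      suc (suc t)  ≡⟨ solve (t ∷ []) ⟩
      t + 2        ≤⟨ +-monoʳ-≤ t (n≤1+n 2) ⟩
      t + 3        ≤⟨ t+3≤k ⟩
      k            ∎
      where open ≤-Reasoning

  private
    2t+3≤k⇒t+1<m : 2 * t + 3 ≤ k → t + 1 < m
    2t+3≤k⇒t+1<m 2t+3≤k = begin
      suc (t + 1)  ≡⟨ solve (t ∷ []) ⟩
      t + 2        ≤⟨ m+n≤o⇒m≤o∸n (t + 2) (≤-trans (≤-reflexive (split t)) 2t+3≤k) ⟩
      k ∸ (t + 1)  ≡⟨ ∸-+-assoc k t 1 ⟨
      k ∸ t ∸ 1    ∎
      where
      open ≤-Reasoning
      split : ∀ t → t + 2 + (t + 1) ≡ 2 * t + 3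
      split = solve-∀

    2m³≤D : 2 * (m * m * m) ≤ D
    2m³≤D = 2*m³≤2*m^[c∸3] 1≤m 6≤c

  cleared : (7 ≤ c × t ^ 4 ≤ 2 ^ (c ∸ 7)) ⊎ 2 * t + 3 ≤ k → Cleared t m (k ∸ t ∸ 2) (k ∸ 1) D
  cleared (inj₂ 2t+3≤k) = cleared-t+1<m m≡1+m₁ k∸1≡m+t 1≤t (2t+3≤k⇒t+1<m 2t+3≤k) 2m³≤D
  cleared (inj₁ (7≤c , t⁴≤2^[c∸7])) with t + 1 <? m
  ... | yes t+1<m = cleared-t+1<m m≡1+m₁ k∸1≡m+t 1≤t t+1<m 2m³≤D
  ... | no t+1≮m  =
    cleared-m≤t+1 m≡1+m₁ k∸1≡m+t 1≤t (≮⇒≥ t+1≮m) (32*t⁴≤2*m^[c∸3] {t} 2≤m 7≤c t⁴≤2^[c∸7])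

open import Data.Product using (_×_; _,_)
open import Data.Sum using (_⊎_)
open import Data.Rational using (_<_; _⊔_)

lemma6p3 : (c k t : ℕ) → 1 ≤ t → 6 ≤ c → t + 3 ≤ k →
    ((7 ≤ c × t ^ 4 ≤ 2 ^ (c ∸ 7)) ⊎ 2 * t + 3 ≤ k) →
    (h₁ c k t < sq (f₀ c k t) ⊔ sq (f₂ c k t))
    × (h₂ c k t < sq (f₀ c k t) ⊔ sq (f₂ c k t))
    × (h₃ c k t < sq (f₀ c k t))
    × (h₄ c k t < sq (f₂ c k t))
lemma6p3 c k t 1≤t 6≤c t+3≤k hyp =
    h<f₀²⊔f₂² ((t + 1) * m) 1 for-h₁
  , h<f₀²⊔f₂² (k ∸ 1) 2 for-h₂
  , h<f₀² m (k ∸ t ∸ 2) for-h₃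
  , h₄<f₂² ((t + 2) ^ 2 ∸ 1) (4 * m ^ (2 * c ∸ 6)) 4m^[2c∸6]≡D*D for-h₄
  where
  open Instance c k t 1≤t 6≤c t+3≤k
  open Comparison.Reduction (Theta.θ-pos c k (1 + t)) Bθ₂≡mθ₁ 2≤m t+1≤t+2 D>0 m³D≤B
  open ClearedForms.Cleared (cleared hyp)
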